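{- Let $n\ge1$ and $\pi\in\mathfrak{S}_n$. If $\Psi_{FZ}(\pi)=(M,w)$, then $\Psi_{FZ}(\pi^{rc})=(M,w)^{rc}$.
   Context: For $\pi\in\mathfrak{S}_n$, $\pi^{rc}$ is the permutation whose $i$-th letter is $n+1-\pi_{n+1-i}$. The Foata–Zeilberger map: with conventions $\pi_0=0$, $\pi_{n+1}=+\infty$, define $\Psi_{FZ}(\pi)=(M,w)$, $M=m_1\cdots m_n$, $w=w_1\cdots w_n$, where for $i\in[n]$ with $\pi_j=i$: $m_i=U$ if $\pi_{j-1}>\pi_j<\pi_{j+1}$; $m_i=D$ if $\pi_{j-1}<\pi_j>\pi_{j+1}$; $m_i=H$ if $\pi_{j-1}<\pi_j<\pi_{j+1}$; $m_i=\tilde H$ if $\pi_{j-1}>\pi_j>\pi_{j+1}$; and $w_i=|\{k: k<j,\ \pi_k<\pi_j=i<\pi_{k-1}\}|$. For a word $M=m_1\cdots m_n$ over $\{U,D,H,\tilde H\}$, the height $h_i(M)$ is the number of $U$'s among $m_1,\dots,m_{i-1}$ minus the number of $D$'s among them. For such a pair $(M,w)$ define $(M,w)^{rc}=(M',w')$ by: $m'_{n+1-i}=m_i$ if $m_i\in\{H,\tilde H\}$, $m'_{n+1-i}=U$ if $m_i=D$, $m'_{n+1-i}=D$ if $m_i=U$; and $w'_{n+1-i}=h_i(M)-w_i$ if $m_i\in\{U,H\}$, $w'_{n+1-i}=h_i(M)-1-w_i$ if $m_i\in\{D,\tilde H\}$. -}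

module Defs where

open import Data.Nat using (ℕ; zero; suc; _∸_; _<ᵇ_; _<?_)
open import Data.Bool using (Bool; true; false; _∧_; if_then_else_)
open import Data.Fin using (Fin; toℕ; fromℕ<; opposite)
open import Data.Fin.Permutation using (Permutation′; _⟨$⟩ʳ_; _⟨$⟩ˡ_; _∘ₚ_; reverse)
open import Data.Integer as ℤ using (ℤ; +_; _-_; 0ℤ; 1ℤ; -1ℤ)
open import Data.List as List using (List; take)
open import Data.Vec as Vec using (Vec; tabulate; lookup; toList)
open import Data.Product using (_×_; _,_)
open import Relation.Nullary using (yes; no)

-- The four step types of a Motzkin-type word: U, D, H and H̃ (written Ht).
data Step : Set where
  U D H Ht : Step

-- A permutation π ∈ 𝔖ₙ is a bijection of Fin n; position j (0-based)
-- holds the value π(j), i.e. the 1-based letter π_{j+1} = toℕ (π j) + 1.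

-- π^{rc}: (π^{rc})_i = n+1-π_{n+1-i}, i.e. opposite ∘ π ∘ opposite.
rc : ∀ {n} → Permutation′ n → Permutation′ n
rc π = reverse ∘ₚ π ∘ₚ reverse

-- Extended 1-based word π_0 π_1 … π_n π_{n+1} with π_0 = 0 and
-- π_{n+1} = +∞, where +∞ is represented by n+1 (larger than all letters).
ext : ∀ {n} → Permutation′ n → ℕ → ℕ
ext π zero = 0
ext {n} π (suc k) with k <? n
... | yes k<n = suc (toℕ (π ⟨$⟩ʳ fromℕ< k<n))
... | no _    = suc n

-- Classify π_j from (π_{j-1}, π_j, π_{j+1}) (letters are distinct).
classify : ℕ → ℕ → ℕ → Step
classify a b c with b <ᵇ a | c <ᵇ b
... | true  | false = U
... | false | true  = D
... | false | false = H
... | true  | true  = Ht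

count : (ℕ → Bool) → ℕ → ℕ
count p zero = 0
count p (suc m) = if p m then suc (count p m) else count p m

-- Foata–Zeilberger map. Index i : Fin n stands for the letter toℕ i + 1;
-- j = 1-based position of that letter.
ΨFZ : ∀ {n} → Permutation′ n → Vec Step n × Vec ℕ n
ΨFZ {n} π = tabulate m , tabulate w
  where
    pos : Fin n → ℕ
    pos i = suc (toℕ (π ⟨$⟩ˡ i))
    m : Fin n → Step
    m i = classify (ext π (pos i ∸ 1)) (ext π (pos i)) (ext π (suc (pos i)))
    -- w_i = #{ k : 1 ≤ k < j, π_k < π_j < π_{k-1} }  (k = suc k')
    w : Fin n → ℕ
    w i = count (λ k' → (ext π (suc k') <ᵇ ext π (pos i)) ∧ (ext π (pos i) <ᵇ ext π k'))
                (toℕ (π ⟨$⟩ˡ i))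

stepHeight : Step → ℤ
stepHeight U  = 1ℤ
stepHeight D  = -1ℤ
stepHeight H  = 0ℤ
stepHeight Ht = 0ℤ

-- h_i(M) = #U − #D among m_1 … m_{i-1}  (i : Fin n is the 1-based index toℕ i + 1)
height : ∀ {n} → Vec Step n → Fin n → ℤ
height M i = List.foldr (λ s acc → stepHeight s ℤ.+ acc) 0ℤ (take (toℕ i) (toList M))

flipStep : Step → Step
flipStep U  = D
flipStep D  = U
flipStep H  = H
flipStep Ht = Ht

weightRC : Step → ℤ → ℕ → ℤ
weightRC U  h w = h - + w
weightRC H  h w = h - + w
weightRC D  h w = (h - 1ℤ) - + w
weightRC Ht h w = (h - 1ℤ) - + w

-- (M,w)^{rc} = (M',w'); weights of the result are integers since
-- h_i(M) − w_i (− 1) is computed in ℤ for an arbitrary pair.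
-- m'_{n+1-i} is indexed by opposite i.
pairRC : ∀ {n} → Vec Step n × Vec ℕ n → Vec Step n × Vec ℤ n
pairRC {n} (M , w) = tabulate M' , tabulate w'
  where
    M' : Fin n → Step
    M' i' = flipStep (lookup M (opposite i'))
    w' : Fin n → ℤ
    w' i' = weightRC (lookup M (opposite i')) (height M (opposite i')) (lookup w (opposite i'))

toℤPair : ∀ {n} → Vec Step n × Vec ℕ n → Vec Step n × Vec ℤ n
toℤPair (M , w) = M , Vec.map +_ w

{-# OPTIONS --safe #-}
module Submission where

-- Extend π by π₀ = 0 and π_{n+1} = n+1, and for a level t count the descents π_k > t ≥ π_{k+1}
-- of the extended word that cross it. Raising the level from i-1 to i only affects the two
-- descents next to the letter i, and changes the count by the height of the step m_i; hence
-- h_i(M) is the number of crossings at level i-1. Those crossings are the descents left of i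
-- straddling i (there are w_i of them), the descent leaving i (present iff m_i ∈ {D, H̃}), and
-- the descents right of i straddling i. Reverse-complementation maps the last ones onto the
-- descents of π^{rc} left of n+1-i straddling n+1-i, which number w'_{n+1-i}; it also swaps the
-- two neighbours of every letter, which exchanges U and D.

open import Defs
open import Data.Nat using (ℕ; zero; suc; _+_; _∸_; _≤_; _<_; _≥_; _<ᵇ_; _<?_; z≤n; s≤s; s≤s⁻¹; z<s)
open import Data.Nat.Properties
open import Data.Bool using (Bool; true; false; _∧_)
open import Data.Bool.Properties using (∧-comm; ∧-zeroʳ; ∧-identityʳ)
open import Data.Fin using (Fin; toℕ; fromℕ<; opposite) renaming (zero to fzero; suc to fsuc)
open import Data.Fin.Properties using (toℕ-fromℕ<; toℕ-injective; toℕ<n; opposite-prop)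
open import Data.Fin.Permutation using (Permutation′; _⟨$⟩ʳ_; _⟨$⟩ˡ_; inverseˡ; inverseʳ)
open import Data.Vec using (Vec; tabulate; lookup)
open import Data.Vec.Properties using (tabulate-cong; tabulate-∘; lookup∘tabulate)
open import Data.Integer as ℤ using (ℤ; _-_; _⊖_; 1ℤ)
import Data.Integer.Properties as ℤP
open import Data.Integer.Solver using (module +-*-Solver)
open import Algebra.Properties.CommutativeSemigroup +-commutativeSemigroup using (x∙yz≈y∙xz)
open import Data.Product using (_,_)
open import Relation.Nullary using (contradiction; yes; no)
open import Relation.Nullary.Reflects using (det; fromEquivalence; ofʸ; ofⁿ)
open import Relation.Binary.PropositionalEquality
open import Function using (_∘_)

open ≡-Reasoning

bit : Bool → ℕ
bit true  = 1
bit false = 0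

count-suc : ∀ P m → count P (suc m) ≡ bit (P m) + count P m
count-suc P m with P m
... | true  = refl
... | false = refl

count-cong : ∀ {P Q} m → (∀ {k} → k < m → P k ≡ Q k) → count P m ≡ count Q m
count-cong zero            eq = refl
count-cong {P} {Q} (suc m) eq = begin
  count P (suc m)        ≡⟨ count-suc P m ⟩
  bit (P m) + count P m  ≡⟨ cong₂ _+_ (cong bit (eq ≤-refl)) (count-cong m (eq ∘ m<n⇒m<1+n)) ⟩
  bit (Q m) + count Q m  ≡⟨ count-suc Q m ⟨
  count Q (suc m)        ∎

count-none : ∀ {P} m → (∀ k → P k ≡ false) → count P m ≡ 0
count-none zero         none = refl
count-none {P} (suc m) none = trans (count-suc P m) (cong₂ _+_ (cong bit (none m)) (count-none m none))

count-split : ∀ P a b → count P (b + a) ≡ count (λ k → P (k + a)) b + count P a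
count-split P a zero = refl
count-split P a (suc b) with P (b + a)
... | true  = cong suc (count-split P a b)
... | false = count-split P a b

count-front : ∀ P m → count P (suc m) ≡ bit (P 0) + count (P ∘ suc) m
count-front P zero    = count-suc P 0
count-front P (suc m) = begin
  count P (suc (suc m))                                ≡⟨ count-suc P (suc m) ⟩
  bit (P (suc m)) + count P (suc m)                    ≡⟨ cong (bit (P (suc m)) +_) (count-front P m) ⟩
  bit (P (suc m)) + (bit (P 0) + count (P ∘ suc) m)    ≡⟨ x∙yz≈y∙xz (bit (P (suc m))) (bit (P 0)) _ ⟩
  bit (P 0) + (bit (P (suc m)) + count (P ∘ suc) m)    ≡⟨ cong (bit (P 0) +_) (count-suc (P ∘ suc) m) ⟨
  bit (P 0) + count (P ∘ suc) (suc m)                  ∎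

count-reverse : ∀ {P Q} m → (∀ a b → suc (a + b) ≡ m → P a ≡ Q b) → count P m ≡ count Q m
count-reverse zero            eq = refl
count-reverse {P} {Q} (suc m) eq = begin
  count P (suc m)                ≡⟨ count-suc P m ⟩
  bit (P m) + count P m          ≡⟨ cong₂ _+_ (cong bit (eq m 0 (cong suc (+-identityʳ m))))
                                              (count-reverse m eq-shifted) ⟩
  bit (Q 0) + count (Q ∘ suc) m  ≡⟨ count-front Q m ⟨
  count Q (suc m)                ∎
  where
    eq-shifted : ∀ a b → suc (a + b) ≡ m → P a ≡ Q (suc b)
    eq-shifted a b e = eq a (suc b) (cong suc (trans (+-suc a b) e))

count-around : ∀ {P L R : ℕ → Bool} {m j b₀ b₁} r → r + suc (suc j) ≡ m →
  (∀ {k} → k < j → P k ≡ L k) → P j ≡ b₀ → P (suc j) ≡ b₁ →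
  (∀ k → P (k + suc (suc j)) ≡ R k) →
  count P m ≡ count R r + (bit b₁ + (bit b₀ + count L j))
count-around {P} {L} {R} {j = j} {b₀} {b₁} r refl left here next right = begin
  count P (r + suc (suc j))
    ≡⟨ count-split P (suc (suc j)) r ⟩
  count (λ k → P (k + suc (suc j))) r + count P (suc (suc j))
    ≡⟨ cong (count (λ k → P (k + suc (suc j))) r +_)
            (trans (count-suc P (suc j)) (cong (bit (P (suc j)) +_) (count-suc P j))) ⟩
  count (λ k → P (k + suc (suc j))) r + (bit (P (suc j)) + (bit (P j) + count P j))
    ≡⟨ cong₂ _+_ (count-cong r (λ {k} _ → right k))
                 (cong₂ _+_ (cong bit next) (cong₂ _+_ (cong bit here) (count-cong j left))) ⟩
  count R r + (bit b₁ + (bit b₀ + count L j)) ∎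

<ᵇ-cong : ∀ {m n m′ n′} → (m < n → m′ < n′) → (m′ < n′ → m < n) → (m <ᵇ n) ≡ (m′ <ᵇ n′)
<ᵇ-cong {m} {n} {m′} {n′} to from =
  det (<ᵇ-reflects-< m n) (fromEquivalence (from ∘ <ᵇ⇒< m′ n′) (<⇒<ᵇ ∘ to))

<ᵇ-irrefl : ∀ t → (t <ᵇ t) ≡ false
<ᵇ-irrefl t = det (<ᵇ-reflects-< t t) (ofⁿ (n≮n t))

n<ᵇ1+n : ∀ t → (t <ᵇ suc t) ≡ true
n<ᵇ1+n t = det (<ᵇ-reflects-< t (suc t)) (ofʸ (n<1+n t))

<ᵇ-skipˡ : ∀ t x → x ≢ suc t → (suc t <ᵇ x) ≡ (t <ᵇ x)
<ᵇ-skipˡ t x x≢1+t = <ᵇ-cong <⇒≤ (λ t<x → ≤∧≢⇒< t<x (x≢1+t ∘ sym))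

<ᵇ-skipʳ : ∀ t x → x ≢ suc t → (x <ᵇ suc (suc t)) ≡ (x <ᵇ suc t)
<ᵇ-skipʳ t x x≢1+t = <ᵇ-cong (λ x<2+t → ≤∧≢⇒< (s≤s⁻¹ x<2+t) x≢1+t) m<n⇒m<1+n

∸-<ᵇ-∸ : ∀ {N x} y → x ≤ N → (N ∸ x <ᵇ N ∸ y) ≡ (y <ᵇ x)
∸-<ᵇ-∸ y x≤N = <ᵇ-cong ∸-cancelʳ-< (λ y<x → ∸-monoʳ-< y<x x≤N)

stepOf : Bool → Bool → Step
stepOf true  false = U
stepOf false true  = D
stepOf false false = H
stepOf true  true  = Ht

classify-stepOf : ∀ a b c → classify a b c ≡ stepOf (b <ᵇ a) (c <ᵇ b)
classify-stepOf a b c with b <ᵇ a | c <ᵇ b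
... | true  | false = refl
... | false | true  = refl
... | false | false = refl
... | true  | true  = refl

stepOf-swap : ∀ A C → stepOf C A ≡ flipStep (stepOf A C)
stepOf-swap true  true  = refl
stepOf-swap true  false = refl
stepOf-swap false true  = refl
stepOf-swap false false = refl

stepHeight-stepOf : ∀ A C → stepHeight (stepOf A C) ≡ ℤ.+ bit A - ℤ.+ bit C
stepHeight-stepOf true  true  = refl
stepHeight-stepOf true  false = refl
stepHeight-stepOf false true  = refl
stepHeight-stepOf false false = refl

classify-∸ : ∀ {N a b} c → a ≤ N → b ≤ N →
  classify (N ∸ c) (N ∸ b) (N ∸ a) ≡ flipStep (classify a b c)
classify-∸ {N} {a} {b} c a≤N b≤N = begin
  classify (N ∸ c) (N ∸ b) (N ∸ a)          ≡⟨ classify-stepOf (N ∸ c) (N ∸ b) (N ∸ a) ⟩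
  stepOf (N ∸ b <ᵇ N ∸ c) (N ∸ a <ᵇ N ∸ b)  ≡⟨ cong₂ stepOf (∸-<ᵇ-∸ c b≤N) (∸-<ᵇ-∸ b a≤N) ⟩
  stepOf (c <ᵇ b) (b <ᵇ a)                  ≡⟨ stepOf-swap (b <ᵇ a) (c <ᵇ b) ⟩
  flipStep (stepOf (b <ᵇ a) (c <ᵇ b))       ≡⟨ cong flipStep (classify-stepOf a b c) ⟨
  flipStep (classify a b c)                 ∎

+[m+n]-n≡m : ∀ m n → ℤ.+ (m + n) - ℤ.+ n ≡ ℤ.+ m
+[m+n]-n≡m m n = trans (cong (_- ℤ.+ n) (ℤP.pos-+ m n))
  (solve 2 (λ m n → (m :+ n) :- n := m) refl (ℤ.+ m) (ℤ.+ n))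
  where open +-*-Solver

+[m+1+n]-1-n≡m : ∀ m n → ℤ.+ (m + suc n) - 1ℤ - ℤ.+ n ≡ ℤ.+ m
+[m+1+n]-1-n≡m m n = trans (cong (λ h → h - 1ℤ - ℤ.+ n) (ℤP.pos-+ m (suc n)))
  (solve 2 (λ m n → (m :+ (con 1ℤ :+ n)) :- con 1ℤ :- n := m) refl (ℤ.+ m) (ℤ.+ n))
  where open +-*-Solver

weightRC-stepOf : ∀ A C w w′ → weightRC (stepOf A C) (ℤ.+ (w′ + (bit C + w))) w ≡ ℤ.+ w′
weightRC-stepOf true  false w w′ = +[m+n]-n≡m w′ w
weightRC-stepOf false false w w′ = +[m+n]-n≡m w′ w
weightRC-stepOf false true  w w′ = +[m+1+n]-1-n≡m w′ w
weightRC-stepOf true  true  w w′ = +[m+1+n]-1-n≡m w′ w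

[r+[a+l]]-[r+[c+l]]≡a-c : ∀ r l a c → ℤ.+ (r + (a + l)) - ℤ.+ (r + (c + l)) ≡ ℤ.+ a - ℤ.+ c
[r+[a+l]]-[r+[c+l]]≡a-c r l a c = begin
  ℤ.+ (r + (a + l)) - ℤ.+ (r + (c + l))  ≡⟨ ℤP.[+m]-[+n]≡m⊖n (r + (a + l)) (r + (c + l)) ⟩
  (r + (a + l)) ⊖ (r + (c + l))          ≡⟨ ℤP.+-cancelˡ-⊖ r (a + l) (c + l) ⟩
  (a + l) ⊖ (c + l)                      ≡⟨ cong₂ _⊖_ (+-comm a l) (+-comm c l) ⟩
  (l + a) ⊖ (l + c)                      ≡⟨ ℤP.+-cancelˡ-⊖ l a c ⟩
  a ⊖ c                                  ≡⟨ ℤP.[+m]-[+n]≡m⊖n a c ⟨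
  ℤ.+ a - ℤ.+ c                          ∎

height-telescope : ∀ {n} (s : Fin n → Step) (d : ℕ → ℤ) →
  (∀ y → stepHeight (s y) ≡ d (suc (toℕ y)) - d (toℕ y)) →
  ∀ x → height (tabulate s) x ≡ d (toℕ x) - d 0
height-telescope s d steps fzero    = sym (ℤP.+-inverseʳ (d 0))
height-telescope s d steps (fsuc y) = begin
  stepHeight (s fzero) ℤ.+ height (tabulate (s ∘ fsuc)) y
    ≡⟨ cong₂ ℤ._+_ (steps fzero) (height-telescope (s ∘ fsuc) (d ∘ suc) (steps ∘ fsuc) y) ⟩
  (d 1 - d 0) ℤ.+ (d (suc (toℕ y)) - d 1)  ≡⟨ ℤP.+-comm (d 1 - d 0) _ ⟩
  (d (suc (toℕ y)) - d 1) ℤ.+ (d 1 - d 0)  ≡⟨ ℤP.+-minus-telescope (d (suc (toℕ y))) (d 1) (d 0) ⟩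
  d (suc (toℕ y)) - d 0                    ∎

descends : (ℕ → ℕ) → ℕ → Bool
descends f k = f (suc k) <ᵇ f k

straddles : (ℕ → ℕ) → ℕ → ℕ → Bool
straddles f x k = (f (suc k) <ᵇ x) ∧ (x <ᵇ f k)

crosses : (ℕ → ℕ) → ℕ → ℕ → Bool
crosses f t k = (f (suc k) <ᵇ suc t) ∧ (t <ᵇ f k)

crossings : (ℕ → ℕ) → ℕ → ℕ → ℕ
crossings f m t = count (crosses f t) m

crossings-zero : ∀ {f} → (∀ k → 0 < f (suc k)) → ∀ m → crossings f m 0 ≡ 0
crossings-zero {f} positive m = count-none m λ k → cong (_∧ (0 <ᵇ f k)) (≮1 (positive k))
  where
    ≮1 : ∀ {x} → 0 < x → (x <ᵇ 1) ≡ false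
    ≮1 z<s = refl

module Letter (f : ℕ → ℕ) {m j v r : ℕ} (length : r + suc (suc j) ≡ m)
              (at : f (suc j) ≡ suc v) (only : ∀ {k} → f k ≡ suc v → k ≡ suc j) where

  into out : Bool
  into = descends f j
  out  = descends f (suc j)

  left right : ℕ
  left  = count (straddles f (suc v)) j
  right = count (λ k → straddles f (suc v) (k + suc (suc j))) r

  crosses-above : ∀ {k} → k ≢ j → crosses f (suc v) k ≡ straddles f (suc v) k
  crosses-above {k} k≢j = cong (_∧ (suc v <ᵇ f k)) (<ᵇ-skipʳ v (f (suc k)) (k≢j ∘ suc-injective ∘ only))

  crosses-below : ∀ {k} → k ≢ suc j → crosses f v k ≡ straddles f (suc v) k
  crosses-below {k} k≢1+j = cong ((f (suc k) <ᵇ suc v) ∧_) (sym (<ᵇ-skipˡ v (f k) (k≢1+j ∘ only)))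

  crosses-above-into : crosses f (suc v) j ≡ into
  crosses-above-into rewrite at | n<ᵇ1+n v = refl

  crosses-above-out : crosses f (suc v) (suc j) ≡ false
  crosses-above-out rewrite at | <ᵇ-irrefl v = ∧-zeroʳ _

  crosses-below-into : crosses f v j ≡ false
  crosses-below-into rewrite at | <ᵇ-irrefl v = refl

  crosses-below-out : crosses f v (suc j) ≡ out
  crosses-below-out rewrite at | n<ᵇ1+n v = ∧-identityʳ _

  left-at : count (straddles f (f (suc j))) j ≡ left
  left-at = cong (λ x → count (straddles f x) j) at

  right-at : count (λ k → straddles f (f (suc j)) (k + suc (suc j))) r ≡ right
  right-at = cong (λ x → count (λ k → straddles f x (k + suc (suc j))) r) at

  classify-letter : classify (f j) (f (suc j)) (f (suc (suc j))) ≡ stepOf into out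
  classify-letter = classify-stepOf (f j) (f (suc j)) (f (suc (suc j)))

  beyond : ∀ k → suc j < k + suc (suc j)
  beyond k = m≤n+m (suc (suc j)) k

  crossings-above : crossings f m (suc v) ≡ right + (bit into + left)
  crossings-above = count-around r length (λ k<j → crosses-above (<⇒≢ k<j))
    crosses-above-into crosses-above-out (λ k → crosses-above (>⇒≢ (<⇒≤ (beyond k))))

  crossings-below : crossings f m v ≡ right + (bit out + left)
  crossings-below = count-around r length (λ k<j → crosses-below (<⇒≢ (m<n⇒m<1+n k<j)))
    crosses-below-into crosses-below-out (λ k → crosses-below (>⇒≢ (beyond k)))

module Complement {N : ℕ} {f g : ℕ → ℕ} (f≤N : ∀ k → f k ≤ N)
                  (g≡N∸f : ∀ a b → a + b ≡ N → g a ≡ N ∸ f b) where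

  g-letter : ∀ {r j} → r + suc (suc j) ≡ N → g (suc r) ≡ N ∸ f (suc j)
  g-letter {r} {j} length = g≡N∸f (suc r) (suc j) (trans (sym (+-suc r (suc j))) length)

  classify-complement : ∀ r j → r + suc (suc j) ≡ N →
    classify (g r) (g (suc r)) (g (suc (suc r))) ≡ flipStep (classify (f j) (f (suc j)) (f (suc (suc j))))
  classify-complement r j length
    rewrite g≡N∸f r (suc (suc j)) length
          | g-letter length
          | g≡N∸f (suc (suc r)) j (trans (sym (+-suc (suc r) j)) (trans (sym (+-suc r (suc j))) length))
          = classify-∸ (f (suc (suc j))) (f≤N j) (f≤N (suc j))

  straddles-complement : ∀ {x l} b → suc b + l ≡ N → x ≤ N → straddles g (N ∸ x) b ≡ straddles f x l
  straddles-complement {x} {l} b length x≤N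
    rewrite g≡N∸f (suc b) l length
          | g≡N∸f b (suc l) (trans (+-suc b l) length)
          | ∸-<ᵇ-∸ x (f≤N l)
          | ∸-<ᵇ-∸ (f (suc l)) x≤N
          = ∧-comm (x <ᵇ f l) (f (suc l) <ᵇ x)

  suffix-straddles : ∀ {r j} → r + suc (suc j) ≡ N →
    count (λ k → straddles f (f (suc j)) (k + suc (suc j))) r ≡ count (straddles g (g (suc r))) r
  suffix-straddles {r} {j} length = count-reverse r mirror
    where
      mirror : ∀ a b → suc (a + b) ≡ r → straddles f (f (suc j)) (a + suc (suc j)) ≡ straddles g (g (suc r)) b
      mirror a b a+1+b≡r = begin
        straddles f (f (suc j)) (a + suc (suc j))  ≡⟨ straddles-complement b b+1+a+2+j≡N (f≤N (suc j)) ⟨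
        straddles g (N ∸ f (suc j)) b              ≡⟨ cong (λ x → straddles g x b) (g-letter length) ⟨
        straddles g (g (suc r)) b                  ∎
        where
          b+1+a+2+j≡N : suc b + (a + suc (suc j)) ≡ N
          b+1+a+2+j≡N = begin
            suc (b + (a + suc (suc j)))  ≡⟨ cong suc (+-assoc b a _) ⟨
            suc (b + a + suc (suc j))    ≡⟨ cong (λ c → suc (c + suc (suc j))) (+-comm b a) ⟩
            suc (a + b) + suc (suc j)    ≡⟨ cong (_+ suc (suc j)) a+1+b≡r ⟩
            r + suc (suc j)              ≡⟨ length ⟩
            N                            ∎

module _ {n : ℕ} (π : Permutation′ n) where

  ext-suc : ∀ {k} (y : Fin n) → toℕ y ≡ k → ext π (suc k) ≡ suc (toℕ (π ⟨$⟩ʳ y))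
  ext-suc {k} y y≡k with k <? n
  ... | yes k<n =
    cong (λ z → suc (toℕ (π ⟨$⟩ʳ z))) (toℕ-injective (trans (toℕ-fromℕ< k<n) (sym y≡k)))
  ... | no  k≮n = contradiction (subst (_< n) y≡k (toℕ<n y)) k≮n

  ext-last : ext π (suc n) ≡ suc n
  ext-last with n <? n
  ... | yes n<n = contradiction n<n (n≮n n)
  ... | no  _   = refl

  ext-≤ : ∀ k → ext π k ≤ suc n
  ext-≤ zero = z≤n
  ext-≤ (suc k) with k <? n
  ... | yes _ = s≤s (<⇒≤ (toℕ<n _))
  ... | no  _ = ≤-refl

  ext-suc-positive : ∀ k → 0 < ext π (suc k)
  ext-suc-positive k with k <? n
  ... | yes _ = z<s
  ... | no  _ = z<s

  ext-letter : ∀ x → ext π (suc (toℕ (π ⟨$⟩ˡ x))) ≡ suc (toℕ x)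
  ext-letter x = trans (ext-suc (π ⟨$⟩ˡ x) refl) (cong (suc ∘ toℕ) (inverseʳ π))

  ext-letter-only : ∀ x {k} → ext π k ≡ suc (toℕ x) → k ≡ suc (toℕ (π ⟨$⟩ˡ x))
  ext-letter-only x {suc k} e with k <? n
  ... | yes k<n = cong suc (begin
    k                                ≡⟨ toℕ-fromℕ< k<n ⟨
    toℕ (fromℕ< k<n)                 ≡⟨ cong toℕ (inverseˡ π) ⟨
    toℕ (π ⟨$⟩ˡ (π ⟨$⟩ʳ fromℕ< k<n))  ≡⟨ cong (toℕ ∘ (π ⟨$⟩ˡ_)) (toℕ-injective (suc-injective e)) ⟩
    toℕ (π ⟨$⟩ˡ x)                   ∎)
  ... | no  _   = contradiction (toℕ<n x) (<-irrefl (sym (suc-injective e)))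

module _ {n : ℕ} (π : Permutation′ n) where

  ext-rc : ∀ a b → a + b ≡ suc n → ext (rc π) a ≡ suc n ∸ ext π b
  ext-rc zero    .(suc n) refl = sym (trans (cong (suc n ∸_) (ext-last π)) (n∸n≡0 (suc n)))
  ext-rc (suc a) zero       e  =
    trans (cong (ext (rc π) ∘ suc) (trans (sym (+-identityʳ a)) (suc-injective e))) (ext-last (rc π))
  ext-rc (suc a) (suc b)    e  = begin
      ext (rc π) (suc a)      ≡⟨ ext-suc (rc π) y (toℕ-fromℕ< a<n) ⟩
      suc (toℕ (opposite w))  ≡⟨ cong suc (opposite-prop w) ⟩
      suc (n ∸ suc (toℕ w))   ≡⟨ +-∸-assoc 1 (toℕ<n w) ⟨
      suc n ∸ suc (toℕ w)     ≡⟨ cong (suc n ∸_) (ext-suc π (opposite y) opposite-y) ⟨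
      suc n ∸ ext π (suc b)   ∎
    where
      1+a+b≡n : suc a + b ≡ n
      1+a+b≡n = trans (sym (+-suc a b)) (suc-injective e)
      a<n : a < n
      a<n = m+n≤o⇒m≤o (suc a) (≤-reflexive 1+a+b≡n)
      y w : Fin n
      y = fromℕ< a<n
      w = π ⟨$⟩ʳ opposite y
      opposite-y : toℕ (opposite y) ≡ b
      opposite-y = begin
        toℕ (opposite y)     ≡⟨ opposite-prop y ⟩
        n ∸ suc (toℕ y)      ≡⟨ cong₂ (λ p q → p ∸ suc q) (sym 1+a+b≡n) (toℕ-fromℕ< a<n) ⟩
        suc a + b ∸ suc a    ≡⟨ m+n∸m≡n (suc a) b ⟩
        b                    ∎

-- ΨFZ π ≡ (tabulate (ΨFZ-step π) , tabulate (ΨFZ-weight π)) holds by refl; Defs defines these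
-- two functions inside a where block.
ΨFZ-step : ∀ {n} → Permutation′ n → Fin n → Step
ΨFZ-step π x = classify (ext π j) (ext π (suc j)) (ext π (suc (suc j)))
  where
    j : ℕ
    j = toℕ (π ⟨$⟩ˡ x)

ΨFZ-weight : ∀ {n} → Permutation′ n → Fin n → ℕ
ΨFZ-weight π x = count (straddles (ext π) (ext π (suc j))) j
  where
    j : ℕ
    j = toℕ (π ⟨$⟩ˡ x)

toℕ-opposite-+ : ∀ {n} (p : Fin n) → toℕ (opposite p) + suc (suc (toℕ p)) ≡ suc n
toℕ-opposite-+ p = trans (+-suc _ (suc (toℕ p)))
  (cong suc (trans (cong (_+ suc (toℕ p)) (opposite-prop p)) (m∸n+n≡m (toℕ<n p))))

module _ {n : ℕ} (π : Permutation′ n) where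

  private
    module AtLetter (x : Fin n) =
      Letter (ext π) (toℕ-opposite-+ (π ⟨$⟩ˡ x)) (ext-letter π x) (ext-letter-only π x)
    open Complement (ext-≤ π) (ext-rc π)

    crossingsℤ : ℕ → ℤ
    crossingsℤ t = ℤ.+ crossings (ext π) (suc n) t

  stepHeight-ΨFZ : ∀ x → stepHeight (ΨFZ-step π x) ≡ crossingsℤ (suc (toℕ x)) - crossingsℤ (toℕ x)
  stepHeight-ΨFZ x = begin
    stepHeight (ΨFZ-step π x)                        ≡⟨ cong stepHeight classify-letter ⟩
    stepHeight (stepOf into out)                     ≡⟨ stepHeight-stepOf into out ⟩
    ℤ.+ bit into - ℤ.+ bit out                       ≡⟨ [r+[a+l]]-[r+[c+l]]≡a-c right left (bit into) (bit out) ⟨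
    ℤ.+ (right + (bit into + left)) - ℤ.+ (right + (bit out + left))
                                                     ≡⟨ cong₂ (λ a b → ℤ.+ a - ℤ.+ b) crossings-above crossings-below ⟨
    crossingsℤ (suc (toℕ x)) - crossingsℤ (toℕ x)    ∎
    where open AtLetter x

  height-ΨFZ : ∀ x → height (tabulate (ΨFZ-step π)) x ≡ crossingsℤ (toℕ x)
  height-ΨFZ x = begin
    height (tabulate (ΨFZ-step π)) x   ≡⟨ height-telescope (ΨFZ-step π) crossingsℤ stepHeight-ΨFZ x ⟩
    crossingsℤ (toℕ x) - crossingsℤ 0  ≡⟨ cong (λ c → crossingsℤ (toℕ x) - ℤ.+ c)
                                               (crossings-zero {ext π} (ext-suc-positive π) (suc n)) ⟩
    crossingsℤ (toℕ x) ℤ.+ ℤ.0ℤ        ≡⟨ ℤP.+-identityʳ (crossingsℤ (toℕ x)) ⟩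
    crossingsℤ (toℕ x)                 ∎

  ΨFZ-step-rc : ∀ i → ΨFZ-step (rc π) i ≡ flipStep (ΨFZ-step π (opposite i))
  ΨFZ-step-rc i = classify-complement _ _ (toℕ-opposite-+ (π ⟨$⟩ˡ opposite i))

  ΨFZ-weight-rc : ∀ i → ℤ.+ ΨFZ-weight (rc π) i ≡
    weightRC (ΨFZ-step π (opposite i)) (height (tabulate (ΨFZ-step π)) (opposite i)) (ΨFZ-weight π (opposite i))
  ΨFZ-weight-rc i = begin
    ℤ.+ ΨFZ-weight (rc π) i
      ≡⟨ cong ℤ.+_ (trans (sym right-at) (suffix-straddles (toℕ-opposite-+ (π ⟨$⟩ˡ x)))) ⟨
    ℤ.+ right
      ≡⟨ weightRC-stepOf into out left right ⟨
    weightRC (stepOf into out) (ℤ.+ (right + (bit out + left))) left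
      ≡⟨ cong₂ (weightRC (stepOf into out)) (trans (cong ℤ.+_ (sym crossings-below)) (sym (height-ΨFZ x)))
                                             (sym left-at) ⟩
    weightRC (stepOf into out) h (ΨFZ-weight π x)
      ≡⟨ cong (λ s → weightRC s h (ΨFZ-weight π x)) classify-letter ⟨
    weightRC (ΨFZ-step π x) h (ΨFZ-weight π x)
      ∎
    where
      x : Fin n
      x = opposite i
      h : ℤ
      h = height (tabulate (ΨFZ-step π)) x
      open AtLetter x

mainTheorem4 : (n : ℕ) → n ≥ 1 → (π : Permutation′ n) →
    toℤPair (ΨFZ (rc π)) ≡ pairRC (ΨFZ π)
mainTheorem4 n _ π =
  cong₂ _,_ (tabulate-cong steps) (trans (sym (tabulate-∘ ℤ.+_ (ΨFZ-weight (rc π)))) (tabulate-cong weights))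
  where
    M : Vec Step n
    M = tabulate (ΨFZ-step π)
    w : Vec ℕ n
    w = tabulate (ΨFZ-weight π)

    steps : ∀ i → ΨFZ-step (rc π) i ≡ flipStep (lookup M (opposite i))
    steps i = trans (ΨFZ-step-rc π i) (cong flipStep (sym (lookup∘tabulate (ΨFZ-step π) (opposite i))))

    weights : ∀ i → ℤ.+ ΨFZ-weight (rc π) i ≡
      weightRC (lookup M (opposite i)) (height M (opposite i)) (lookup w (opposite i))
    weights i = trans (ΨFZ-weight-rc π i)
      (cong₂ (λ s k → weightRC s (height M (opposite i)) k)
             (sym (lookup∘tabulate (ΨFZ-step π) (opposite i)))
             (sym (lookup∘tabulate (ΨFZ-weight π) (opposite i))))
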